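{- Let $\alpha\in\{+,-\}$ and let $G$ be a bidirected graph with a vertex $r\in V(G)$ such that no $(-\alpha,-\alpha)$-ditrail from $x$ to $r$ exists for any $x\in V(G)$. Let $x\in V(G)$ and let $P$ be an $(\alpha,-\alpha)$-ditrail from $x$ to $r$. Then for any vertex term $w$ of $P$ other than the last one, $xPw$ is an $(\alpha,-\alpha)$-ditrail from $x$ to $w$ and $wPr$ is an $(\alpha,-\alpha)$-ditrail from $w$ to $r$. Accordingly, every edge in $P$ is an $(\alpha,-\alpha)$-edge.
   Context: A bidirected graph $G$ is a finite graph (loops and parallel edges allowed) with maps $\partial_+,\partial_-:E(G)\to 2^{V(G)}$ such that for each edge $e$ with (possibly identical) ends $u,v$: $\partial_\alpha(e)\subseteq\{u,v\}$, $\partial_+(e)\cup\partial_-(e)=\{u,v\}$, and $\partial_+(e)\cap\partial_-(e)=\emptyset$ if $e$ is not a loop. If $u\in\partial_\alpha(e)$, the sign of $u$ over $e$ is $\alpha$; $-\alpha$ denotes the opposite sign. An edge is an $(\alpha,\alpha)$-edge if all its ends have sign $\alpha$ over it, and an $(\alpha,-\alpha)$-edge (equivalently a $(+,-)$-edge) if both $\partial_+(e)$ and $\partial_-(e)$ are nonempty. A walk is a sequence $W=(w_1,\dots,w_k)$, $k$ odd, with $w_i$ a vertex for odd $i$ and $w_i$ an edge joining $w_{i-1},w_{i+1}$ for even $i$; the entries are its terms, odd-indexed ones vertex terms; for vertex terms $t_i,t_j$, $i\le j$, $t_iWt_j$ denotes the subwalk $(w_i,\dots,w_j)$. A trail has no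 repeated edge. $W$ is a diwalk if to each traversal of an edge $w_i$ one can assign signs to its end-occurrences equal to the signs of these vertices over $w_i$ (for a loop with one end $+$ and one end $-$, the two assigned signs are distinct), such that at every internal vertex term the signs assigned from the preceding and following edges are distinct. A ditrail is a diwalk that is a trail. For $k\ge3$ the sign of $w_1$ (resp. $w_k$) over $W$ is the sign assigned at $w_2$ (resp. $w_{k-1}$); $W$ is an $(\alpha,\beta)$-ditrail if these are $\alpha,\beta$; the trivial ditrail $(v)$ counts as both a $(+,-)$- and a $(-,+)$-ditrail. -}

module Defs where

open import Data.Nat using (ℕ; zero; suc)
open import Data.Fin using (Fin)
open import Data.Bool using (Bool; true; false)
open import Data.List using (List; []; _∷_; map; take; drop; length)
open import Data.Product using (_×_; _,_; proj₁; proj₂)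
open import Data.Sum using (_⊎_)
open import Data.Unit using (⊤)
open import Relation.Binary.PropositionalEquality using (_≡_; _≢_)
open import Data.List.Relation.Unary.Unique.Propositional using (Unique)

data Sign : Set where
  ⊕ ⊖ : Sign

neg : Sign → Sign
neg ⊕ = ⊖
neg ⊖ = ⊕

-- Edge e has end-occurrences (end₁ e, sg₁ e) and (end₂ e, sg₂ e):
--   ∂_α(e) = { end_j e | sg_j e ≡ α }.
-- This covers exactly the admissible configurations: for a non-loop each
-- end has exactly one sign; for a loop the signs may be (+,+), (-,-) or
-- (+,-) (the last one meaning ∂₊(e) = ∂₋(e) = {u}).
record BiGraph : Set where
  field
    nV nE : ℕ
    end₁ end₂ : Fin nE → Fin nV
    sg₁ sg₂ : Fin nE → Sign

module _ (G : BiGraph) where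
  open BiGraph G

  Vertex : Set
  Vertex = Fin nV

  Edge : Set
  Edge = Fin nE

  -- an (α,-α)-edge: both ∂₊(e) and ∂₋(e) nonempty
  IsPMEdge : Edge → Set
  IsPMEdge e = sg₁ e ≢ sg₂ e

  Joins : Edge → Vertex → Vertex → Set
  Joins e u v = (end₁ e ≡ u × end₂ e ≡ v) ⊎ (end₂ e ≡ u × end₁ e ≡ v)

  record Walk : Set where
    constructor walk
    field
      start : Vertex
      steps : List (Edge × Vertex)

  IsWalkFrom : Vertex → List (Edge × Vertex) → Set
  IsWalkFrom u [] = ⊤
  IsWalkFrom u ((e , v) ∷ ss) = Joins e u v × IsWalkFrom v ss

  IsWalk : Walk → Set
  IsWalk (walk s ss) = IsWalkFrom s ss

  IsTrail : Walk → Set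
  IsTrail W = IsWalk W × Unique (map proj₁ (Walk.steps W))

  -- vertex term number i (0-based) of the walk starting at u
  vtxFrom : Vertex → List (Edge × Vertex) → ℕ → Vertex
  vtxFrom u [] i = u
  vtxFrom u (_ ∷ _) zero = u
  vtxFrom u ((_ , v) ∷ ss) (suc i) = vtxFrom v ss i

  vtx : Walk → ℕ → Vertex
  vtx (walk s ss) i = vtxFrom s ss i

  lastV : Walk → Vertex
  lastV W = vtx W (length (Walk.steps W))

  prefix : Walk → ℕ → Walk
  prefix (walk s ss) i = walk s (take i ss)

  suffix : Walk → ℕ → Walk
  suffix W i = walk (vtx W i) (drop i (Walk.steps W))

  Oriented : Edge → Bool → Vertex → Vertex → Set
  Oriented e true  u v = end₁ e ≡ u × end₂ e ≡ v
  Oriented e false u v = end₂ e ≡ u × end₁ e ≡ v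

  depSign : Edge → Bool → Sign
  depSign e true  = sg₁ e
  depSign e false = sg₂ e

  arrSign : Edge → Bool → Sign
  arrSign e true  = sg₂ e
  arrSign e false = sg₁ e

  -- DiAssign u ss α β : the nontrivial walk (u, ss) admits a sign assignment
  -- making it a diwalk, in which the first vertex has sign α and the last
  -- vertex has sign β over the walk.
  data DiAssign : Vertex → List (Edge × Vertex) → Sign → Sign → Set where
    one  : ∀ {u e v α β} (o : Bool) → Oriented e o u v →
           depSign e o ≡ α → arrSign e o ≡ β →
           DiAssign u ((e , v) ∷ []) α β
    cons : ∀ {u e v ss α γ β} (o : Bool) → Oriented e o u v →
           depSign e o ≡ α → arrSign e o ≢ γ → DiAssign v ss γ β →
           DiAssign u ((e , v) ∷ ss) α β

  -- sign condition of an (α,β)-ditrail; the trivial walk counts as both a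
  -- (+,-)- and a (-,+)-ditrail, i.e. as an (α,β)-ditrail iff α ≠ β.
  DiSigns : Vertex → List (Edge × Vertex) → Sign → Sign → Set
  DiSigns u [] α β = α ≢ β
  DiSigns u (st ∷ ss) α β = DiAssign u (st ∷ ss) α β

  IsDitrail : Sign → Sign → Walk → Set
  IsDitrail α β W = IsTrail W × DiSigns (Walk.start W) (Walk.steps W) α β

  IsDitrailFromTo : Sign → Sign → Vertex → Vertex → Walk → Set
  IsDitrailFromTo α β x y W = IsDitrail α β W × Walk.start W ≡ x × lastV W ≡ y

module Submission where

-- Let P = (x, e₁, v₁, …, e_k, r) be an (α,-α)-ditrail to r.
-- If its first edge e₁ is entered at v₁ with sign γ' and the tail v₁Pr is
-- a (γ,-α)-ditrail, then γ ≠ -α, since otherwise the tail would be a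
-- forbidden (-α,-α)-ditrail to r; with only two signs, γ = α and
-- γ' = -α.  So e₁ is traversed as an (α,-α)-step and the tail is again an
-- (α,-α)-ditrail to r ("peeling", lemma peel).  Induction along P then
-- gives all three claims:
--   * every suffix wPr is an (α,-α)-ditrail to r (suffix-ditrail),
--   * every edge of P is an (α,-α)-edge (edges-PM),
--   * every prefix xPw is an (α,-α)-ditrail, because prepending an
--     (α,-α)-step to an (α,-α)-ditrail keeps it one (step-cons), and
--     prefixes of trails are trails (trail-take).
-- Both the suffix and the prefix claims hold for every index i, so the
-- bound i < length in the statement is not needed.

open import Defs
open import Data.Nat using (zero; suc; _<_)
open import Data.Bool using (Bool; true; false)
open import Data.List using ([]; _∷_; take; drop; length)
open import Data.List.Properties using (take-map)
open import Data.List.Relation.Unary.All using (All; []; _∷_)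
open import Data.List.Relation.Unary.AllPairs using ([]; _∷_)
import Data.List.Relation.Unary.AllPairs as AllPairs
open import Data.List.Relation.Unary.Unique.Propositional using (Unique)
open import Data.List.Relation.Unary.Unique.Propositional.Properties using (take⁺)
open import Data.Product using (_×_; _,_; proj₁; proj₂)
open import Data.Unit using (tt)
open import Data.Empty using (⊥-elim)
open import Relation.Nullary using (¬_)
open import Relation.Binary.PropositionalEquality using (_≡_; _≢_; refl; sym; trans; subst)

sign≢neg : ∀ α → α ≢ neg α
sign≢neg ⊕ ()
sign≢neg ⊖ ()

≢-same⇒≡ : ∀ {a b c : Sign} → a ≢ c → b ≢ c → a ≡ b
≢-same⇒≡ {⊕} {⊕} _ _ = refl
≢-same⇒≡ {⊖} {⊖} _ _ = refl
≢-same⇒≡ {⊕} {⊖} {⊕} a≢c _ = ⊥-elim (a≢c refl)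
≢-same⇒≡ {⊕} {⊖} {⊖} _ b≢c = ⊥-elim (b≢c refl)
≢-same⇒≡ {⊖} {⊕} {⊕} _ b≢c = ⊥-elim (b≢c refl)
≢-same⇒≡ {⊖} {⊕} {⊖} a≢c _ = ⊥-elim (a≢c refl)

module _ (G : BiGraph) where

  data Step (α : Sign) (e : Edge G) (u v : Vertex G) : Set where
    step : (o : Bool) → Oriented G e o u v →
           depSign G e o ≡ α → arrSign G e o ≡ neg α → Step α e u v

  step-PM : ∀ {α e u v} → Step α e u v → IsPMEdge G e
  step-PM {α} (step true  _ dep arr) sg₁≡sg₂ =
    sign≢neg α (trans (sym dep) (trans sg₁≡sg₂ arr))
  step-PM {α} (step false _ dep arr) sg₁≡sg₂ =
    sign≢neg α (trans (sym dep) (trans (sym sg₁≡sg₂) arr))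

  step-cons : ∀ {α e u v} ts → Step α e u v →
              DiSigns G v ts α (neg α) → DiSigns G u ((e , v) ∷ ts) α (neg α)
  step-cons []       (step o or dep arr) _ = one o or dep arr
  step-cons {α} (t ∷ ts) (step o or dep arr) D =
    cons o or dep (λ arr≡α → sign≢neg α (trans (sym arr≡α) arr)) D

  assign⇒signs : ∀ {u ss α β} → DiAssign G u ss α β → DiSigns G u ss α β
  assign⇒signs D@(one _ _ _ _)    = D
  assign⇒signs D@(cons _ _ _ _ _) = D

  trail-tail : ∀ {u e v ss} → IsTrail G (walk u ((e , v) ∷ ss)) → IsTrail G (walk v ss)
  trail-tail ((_ , w) , uq) = w , AllPairs.tail uq

  walk-take : ∀ {u} ss j → IsWalkFrom G u ss → IsWalkFrom G u (take j ss)
  walk-take ss       zero    _       = tt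
  walk-take []       (suc j) _       = tt
  walk-take (_ ∷ ss) (suc j) (e , w) = e , walk-take ss j w

  trail-take : ∀ {u} ss j → IsTrail G (walk u ss) → IsTrail G (walk u (take j ss))
  trail-take ss j (w , uq) =
    walk-take ss j w , subst Unique (take-map j ss) (take⁺ j uq)

  last-take : ∀ u ss i → lastV G (walk u (take i ss)) ≡ vtxFrom G u ss i
  last-take u []             zero    = refl
  last-take u []             (suc i) = refl
  last-take u (_ ∷ _)        zero    = refl
  last-take u ((_ , v) ∷ ss) (suc i) = last-take v ss i

module Rooted (G : BiGraph) (α : Sign) (r : Vertex G)
  (no-neg-neg : ∀ (x : Vertex G) (W : Walk G) → ¬ IsDitrailFromTo G (neg α) (neg α) x r W)
  where

  Ditrail : Vertex G → Vertex G → Walk G → Set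
  Ditrail = IsDitrailFromTo G α (neg α)

  -- The sign γ of the tail at its
  -- start cannot be -α (no (-α,-α)-ditrail ends at r), hence γ = α, and the
  -- entering sign of the first edge, which differs from γ, is -α.
  peel : ∀ {u e v ss} → Ditrail u r (walk u ((e , v) ∷ ss)) →
         Step G α e u v × Ditrail v r (walk v ss)
  peel ((_ , one o or dep arr) , _ , last) =
    step o or dep arr , ((tt , []) , sign≢neg α) , refl , last
  peel {v = v} {ss = ss} ((trail , cons {γ = γ} o or dep arr≢γ D) , _ , last) =
    step o or dep arr≡negα , (tail , assign⇒signs G D-α) , refl , last
    where
    tail : IsTrail G (walk v ss)
    tail = trail-tail G trail

    tail-with : ∀ {δ} → δ ≡ γ → DiAssign G v ss δ (neg α)
    tail-with refl = D

    γ≢negα : γ ≢ neg α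
    γ≢negα γ≡negα =
      no-neg-neg v (walk v ss) ((tail , assign⇒signs G (tail-with (sym γ≡negα))) , refl , last)

    γ≡α : γ ≡ α
    γ≡α = ≢-same⇒≡ γ≢negα (sign≢neg α)

    D-α : DiAssign G v ss α (neg α)
    D-α = tail-with (sym γ≡α)

    arr≡negα : arrSign G _ o ≡ neg α
    arr≡negα = ≢-same⇒≡ (λ arr≡α → arr≢γ (trans arr≡α (sym γ≡α)))
                        (λ negα≡α → sign≢neg α (sym negα≡α))

  suffix-ditrail : ∀ u ss i → Ditrail u r (walk u ss) →
                   Ditrail (vtxFrom G u ss i) r (walk (vtxFrom G u ss i) (drop i ss))
  suffix-ditrail u []             zero    P = P
  suffix-ditrail u []             (suc i) P = P
  suffix-ditrail u (_ ∷ _)        zero    P = P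
  suffix-ditrail u ((_ , v) ∷ ss) (suc i) P = suffix-ditrail v ss i (proj₂ (peel P))

  prefix-signs : ∀ u ss i → Ditrail u r (walk u ss) → DiSigns G u (take i ss) α (neg α)
  prefix-signs u ss             zero    _ = sign≢neg α
  prefix-signs u []             (suc i) _ = sign≢neg α
  prefix-signs u ((_ , v) ∷ ss) (suc i) P =
    step-cons G (take i ss) (proj₁ (peel P)) (prefix-signs v ss i (proj₂ (peel P)))

  prefix-ditrail : ∀ u ss i → Ditrail u r (walk u ss) →
                   Ditrail u (vtxFrom G u ss i) (walk u (take i ss))
  prefix-ditrail u ss i P@((trail , _) , _) =
    (trail-take G ss i trail , prefix-signs u ss i P) , refl , last-take G u ss i

  edges-PM : ∀ u ss → Ditrail u r (walk u ss) → All (λ st → IsPMEdge G (proj₁ st)) ss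
  edges-PM u []             _ = []
  edges-PM u ((_ , v) ∷ ss) P = step-PM G (proj₁ (peel P)) ∷ edges-PM v ss (proj₂ (peel P))

lemma11p2 : (G : BiGraph) (α : Sign) (r : Vertex G) →
    (∀ (x : Vertex G) (W : Walk G) → ¬ IsDitrailFromTo G (neg α) (neg α) x r W) →
    (x : Vertex G) (P : Walk G) → IsDitrailFromTo G α (neg α) x r P →
    (∀ i → i < length (Walk.steps P) →
        IsDitrailFromTo G α (neg α) x (vtx G P i) (prefix G P i)
        × IsDitrailFromTo G α (neg α) (vtx G P i) r (suffix G P i))
    × All (λ st → IsPMEdge G (proj₁ st)) (Walk.steps P)
lemma11p2 G α r no-neg-neg x (walk u ss) P@(_ , refl , _) =
  (λ i _ → prefix-ditrail u ss i P , suffix-ditrail u ss i P) , edges-PM u ss P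
  where open Rooted G α r no-neg-neg
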